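{- Let $n$ and $p$ be positive integers (not necessarily coprime) and let $\kappa$ be an $n,p$-core. Then $H_{n,p}(\kappa)=H_{p,n}(\kappa)$ as multisets.
   Context: A partition $\lambda$ is identified with its Young diagram $\{(i,j): i\in[\ell(\lambda)], j\in[\lambda_i]\}$ (row $i$, column $j$, rows numbered from the top); its elements are cells. The conjugate $\lambda'$ has $\lambda'_i=\#\{j:\lambda_j\ge i\}$. The hook length of cell $(i,j)$ is $h_\lambda(i,j)=\lambda_i-j+\lambda'_j-i+1$. A partition is an $n$-core if no cell has hook length $n$, and an $n,p$-core if it is both an $n$-core and a $p$-core. For an $n,p$-core $\kappa$ let $m$ be the hook length of the top-left cell (the maximal hook length). Let $H^c(m)$ be the set of hook lengths of the cells in the first column of $\kappa$ and $H^r(m)$ the set of hook lengths of the cells in the first row. For $h\in H^c(m)$, the row whose leftmost cell has hook length $h$ is called an $n$-row if $h+n\notin H^c(m)$ (and a $p$-row if $h+p\notin H^c(m)$). For $h\in H^r(m)$, the column whose top cell has hook length $h$ is called an $n$-column if $h+n\notin H^r(m)$ (and a $p$-column if $h+p\notin H^r(m)$). $H_{n,p}(\kappa)$ denotes the multiset of hook lengths of the cells of $\kappa$ that lie both in an $n$-row and in a $p$-column; $H_{p,n}(\kappa)$ is defined likewise with the roles of $n$ and $p$ exchanged (cells lying in a $p$-row and an $n$-column). -}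

module Defs where

open import Data.Nat using (ℕ; zero; suc; _+_; _∸_; _≥_; _≤ᵇ_; _≡ᵇ_)
open import Data.Bool using (Bool; true; false; not; _∧_; if_then_else_)
open import Data.List using (List; []; _∷_; length; map; filter; concatMap; upTo)
open import Data.Bool.ListAction using (any)
open import Data.List.Relation.Unary.All using (All)
open import Data.List.Relation.Binary.Permutation.Propositional using (_↭_)
open import Data.List.Relation.Unary.Linked using (Linked)
open import Data.Product using (_×_; _,_; proj₁; proj₂)
open import Relation.Binary.PropositionalEquality using (_≢_)
open import Relation.Nullary.Decidable using (does)
open import Data.Bool using (T)

record Partition : Set where
  constructor mkPartition
  field
    parts      : List ℕ
    decreasing : Linked _≥_ parts
    positive   : All (λ k → 1 Data.Nat.≤ k) parts
open Partition public

len : Partition → ℕ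
len κ = length (parts κ)

-- λ_i, 1-indexed; 0 outside 1..ℓ
partAt : List ℕ → ℕ → ℕ
partAt []       _             = 0
partAt (x ∷ xs) zero          = 0
partAt (x ∷ xs) (suc zero)    = x
partAt (x ∷ xs) (suc (suc i)) = partAt xs (suc i)

row : Partition → ℕ → ℕ
row κ i = partAt (parts κ) i

conj : Partition → ℕ → ℕ
conj κ j = length (filter (λ k → j Data.Nat.≤? k) (parts κ))

oneTo : ℕ → List ℕ
oneTo n = map suc (upTo n)

cells : Partition → List (ℕ × ℕ)
cells κ = concatMap (λ i → map (λ j → (i , j)) (oneTo (row κ i))) (oneTo (len κ))

-- hook length h(i,j) = λ_i - j + λ'_j - i + 1  (for cells, no truncation occurs)
hook : Partition → ℕ × ℕ → ℕ
hook κ (i , j) = (row κ i ∸ j) + (conj κ j ∸ i) + 1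

IsCore : ℕ → Partition → Set
IsCore n κ = ∀ c → c Data.List.Membership.Propositional.∈ cells κ → hook κ c ≢ n
  where import Data.List.Membership.Propositional

Hc : Partition → List ℕ
Hc κ = map (λ i → hook κ (i , 1)) (oneTo (len κ))

Hr : Partition → List ℕ
Hr κ = map (λ j → hook κ (1 , j)) (oneTo (row κ 1))

elemᵇ : ℕ → List ℕ → Bool
elemᵇ x xs = any (λ y → x ≡ᵇ y) xs

isRowᵇ : ℕ → Partition → ℕ → Bool
isRowᵇ n κ i = not (elemᵇ (hook κ (i , 1) + n) (Hc κ))

isColᵇ : ℕ → Partition → ℕ → Bool
isColᵇ p κ j = not (elemᵇ (hook κ (1 , j) + p) (Hr κ))

Hnp : ℕ → ℕ → Partition → List ℕ
Hnp n p κ = map (hook κ)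
  (filter (λ c → T? (isRowᵇ n κ (proj₁ c) ∧ isColᵇ p κ (proj₂ c))) (cells κ))
  where
  open import Relation.Nullary.Decidable using (Dec; yes; no)
  T? : (b : Bool) → Dec (T b)
  T? = Data.Bool.T?

-- Read the first-column hook lengths H^c of κ as the beads of an abacus (all negative positions also carry beads).
-- With m the maximal hook length, H^r is the mirror image m − z of the gaps of H^c in [0, m], and the hook length of
-- cell (i, j) is a + b − m for a, b the hook lengths starting row i and column j.  So a hook h in an n-row and
-- p-column is the same as a bead x with x + n a gap, x − h a gap and x − h − p a bead.  Being an n- and a p-core
-- means beads can slide down by n and by p, and under this monotonicity the number of such x is
-- C(h + p) + C(h + n) − C(h) − C(h + n + p), where C(e) counts the beads x for which x − e is a bead too.
-- This expression is symmetric in n and p.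
module Submission where

open import Data.Bool as Bool using (Bool; true; false; not; _∧_; _∨_; f≤t; b≤b)
open import Data.Bool.Properties using (not-involutive; ≤-maximum; ∧-identityʳ)
open import Data.Empty using (⊥; ⊥-elim)
open import Data.List using (List; []; _∷_; _++_; map; filter; concatMap; applyUpTo; upTo; length)
open import Data.List.Properties using (map-upTo; map-applyUpTo)
open import Data.List.Relation.Unary.All using (All; []; _∷_)
open import Data.List.Relation.Unary.Linked as Linked using (Linked; _∷_)
open import Data.List.Membership.Propositional using (_∈_; lose)
open import Data.List.Membership.Propositional.Properties using (∈-map⁺; ∈-concatMap⁺; ∈-upTo⁺)
open import Data.List.Relation.Binary.Permutation.Propositional
  using (_↭_; prep; swap; ↭-refl; ↭-trans; ↭-sym)
open import Data.Nat
open import Data.Nat.Properties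
open import Data.Nat.Tactic.RingSolver using (solve-∀)
open import Algebra.Properties.CommutativeSemigroup +-commutativeSemigroup
  using () renaming (interchange to +-interchange; x∙yz≈y∙xz to +-left-comm; xy∙z≈xz∙y to +-right-comm)
open import Data.Product using (_×_; _,_; proj₁; proj₂; Σ-syntax)
open import Function using (_∘_; mk⇔)
open import Relation.Binary.PropositionalEquality
open import Relation.Nullary using (yes; no; does)
open import Relation.Nullary.Decidable using (dec-true; dec-false; does-⇔)
open import Defs

𝟙 : Bool → ℕ
𝟙 true  = 1
𝟙 false = 0

𝟙-∧ : ∀ a b → 𝟙 (a ∧ b) ≡ 𝟙 a * 𝟙 b
𝟙-∧ true  b = sym (+-identityʳ (𝟙 b))
𝟙-∧ false b = refl

𝟙-disjoint : ∀ a b → (a ≡ true → b ≡ true → ⊥) → 𝟙 a + 𝟙 b ≤ 1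
𝟙-disjoint true  true  disjoint = ⊥-elim (disjoint refl refl)
𝟙-disjoint true  false _        = ≤-refl
𝟙-disjoint false b     _        = 𝟙≤1 b
  where
  𝟙≤1 : ∀ b → 𝟙 b ≤ 1
  𝟙≤1 true  = ≤-refl
  𝟙≤1 false = z≤n

𝟙+𝟙≡1⇒≡not : ∀ a b → 𝟙 a + 𝟙 b ≡ 1 → b ≡ not a
𝟙+𝟙≡1⇒≡not true  false _ = refl
𝟙+𝟙≡1⇒≡not false true  _ = refl

≡ᵇ-refl : ∀ x → (x ≡ᵇ x) ≡ true
≡ᵇ-refl x = dec-true (x ≟ x) refl

≡ᵇ-true⇒≡ : ∀ x y → (x ≡ᵇ y) ≡ true → x ≡ y
≡ᵇ-true⇒≡ x y eq = ≡ᵇ⇒≡ x y (subst Bool.T (sym eq) _)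

sumTo : ℕ → (ℕ → ℕ) → ℕ
sumTo zero    f = 0
sumTo (suc k) f = f 0 + sumTo k (f ∘ suc)

module _ where
  open ≡-Reasoning

  sumTo-cong : ∀ k {f g} → (∀ i → i < k → f i ≡ g i) → sumTo k f ≡ sumTo k g
  sumTo-cong zero    eq = refl
  sumTo-cong (suc k) eq = cong₂ _+_ (eq 0 z<s) (sumTo-cong k (λ i i<k → eq (suc i) (s<s i<k)))

  sumTo-+ : ∀ k l f → sumTo (k + l) f ≡ sumTo k f + sumTo l (λ i → f (k + i))
  sumTo-+ zero    l f = refl
  sumTo-+ (suc k) l f = trans (cong (f 0 +_) (sumTo-+ k l (f ∘ suc))) (sym (+-assoc (f 0) _ _))

  sumTo-zero : ∀ k {f} → (∀ i → i < k → f i ≡ 0) → sumTo k f ≡ 0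
  sumTo-zero zero    eq = refl
  sumTo-zero (suc k) eq = cong₂ _+_ (eq 0 z<s) (sumTo-zero k (λ i i<k → eq (suc i) (s<s i<k)))

  sumTo-ones : ∀ k {f} → (∀ i → i < k → f i ≡ 1) → sumTo k f ≡ k
  sumTo-ones zero    eq = refl
  sumTo-ones (suc k) eq = cong₂ _+_ (eq 0 z<s) (sumTo-ones k (λ i i<k → eq (suc i) (s<s i<k)))

  sumTo-distrib : ∀ k f g → sumTo k (λ i → f i + g i) ≡ sumTo k f + sumTo k g
  sumTo-distrib zero    f g = refl
  sumTo-distrib (suc k) f g =
    trans (cong (f 0 + g 0 +_) (sumTo-distrib k (f ∘ suc) (g ∘ suc))) (+-interchange (f 0) (g 0) _ _)

  sumTo-*ˡ : ∀ k c f → sumTo k (λ i → c * f i) ≡ c * sumTo k f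
  sumTo-*ˡ zero    c f = sym (*-zeroʳ c)
  sumTo-*ˡ (suc k) c f = trans (cong (c * f 0 +_) (sumTo-*ˡ k c (f ∘ suc))) (sym (*-distribˡ-+ c (f 0) _))

  sumTo-mono-≤ : ∀ k {f g} → (∀ i → i < k → f i ≤ g i) → sumTo k f ≤ sumTo k g
  sumTo-mono-≤ zero    le = z≤n
  sumTo-mono-≤ (suc k) le = +-mono-≤ (le 0 z<s) (sumTo-mono-≤ k (λ i i<k → le (suc i) (s<s i<k)))

  sumTo-snoc : ∀ k f → sumTo (suc k) f ≡ sumTo k f + f k
  sumTo-snoc k f = begin
    sumTo (suc k) f                   ≡⟨ cong (λ l → sumTo l f) (+-comm 1 k) ⟩
    sumTo (k + 1) f                   ≡⟨ sumTo-+ k 1 f ⟩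
    sumTo k f + (f (k + 0) + 0)       ≡⟨ cong (sumTo k f +_) (trans (+-identityʳ _) (cong f (+-identityʳ k))) ⟩
    sumTo k f + f k                   ∎

  sumTo-reverse : ∀ k f → sumTo (suc k) (λ i → f (k ∸ i)) ≡ sumTo (suc k) f
  sumTo-reverse zero    f = refl
  sumTo-reverse (suc k) f = begin
    f (suc k) + sumTo (suc k) (λ i → f (k ∸ i))  ≡⟨ cong (f (suc k) +_) (sumTo-reverse k f) ⟩
    f (suc k) + sumTo (suc k) f                  ≡⟨ +-comm (f (suc k)) _ ⟩
    sumTo (suc k) f + f (suc k)                  ≡⟨ sym (sumTo-snoc (suc k) f) ⟩
    sumTo (suc (suc k)) f                        ∎

  sumTo-vanishing : ∀ {k l} f → (∀ i → k ≤ i → i < l → f i ≡ 0) → k ≤ l → sumTo l f ≡ sumTo k f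
  sumTo-vanishing {k} {l} f vanish k≤l = begin
    sumTo l f                                    ≡⟨ cong (λ l → sumTo l f) (sym (m+[n∸m]≡n k≤l)) ⟩
    sumTo (k + (l ∸ k)) f                        ≡⟨ sumTo-+ k (l ∸ k) f ⟩
    sumTo k f + sumTo (l ∸ k) (λ i → f (k + i))  ≡⟨ cong (sumTo k f +_) (sumTo-zero (l ∸ k) tail≡0) ⟩
    sumTo k f + 0                                ≡⟨ +-identityʳ _ ⟩
    sumTo k f                                    ∎
    where
    tail≡0 : ∀ i → i < l ∸ k → f (k + i) ≡ 0
    tail≡0 i i<l∸k = vanish (k + i) (m≤m+n k i) (subst (k + i <_) (m+[n∸m]≡n k≤l) (+-monoʳ-< k i<l∸k))

  sumTo-δ : ∀ k c (G : ℕ → ℕ) → (k ≤ c → G c ≡ 0) → sumTo k (λ i → 𝟙 (i ≡ᵇ c) * G i) ≡ G c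
  sumTo-δ zero    c       G vanish = sym (vanish z≤n)
  sumTo-δ (suc k) zero    G vanish = begin
    G 0 + 0 + sumTo k (λ i → 𝟙 (suc i ≡ᵇ 0) * G (suc i))
      ≡⟨ cong (G 0 + 0 +_) (sumTo-zero k {λ i → 𝟙 (suc i ≡ᵇ 0) * G (suc i)} (λ _ _ → refl)) ⟩
    G 0 + 0 + 0
      ≡⟨ trans (+-identityʳ _) (+-identityʳ _) ⟩
    G 0 ∎
  sumTo-δ (suc k) (suc c) G vanish = sumTo-δ k c (G ∘ suc) (vanish ∘ s≤s)

  sumTo-saturated : ∀ k {f} → (∀ i → i < k → f i ≤ 1) → sumTo k f ≡ k → ∀ i → i < k → f i ≡ 1
  sumTo-saturated (suc k) {f} ≤1 total = λ
    { zero    _         → f0≡1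
    ; (suc i) (s<s i<k) → sumTo-saturated k (λ i i<k → ≤1 (suc i) (s<s i<k)) rest≡k i i<k }
    where
    rest≤k : sumTo k (f ∘ suc) ≤ k
    rest≤k = subst (sumTo k (f ∘ suc) ≤_) (sumTo-ones k {λ _ → 1} (λ _ _ → refl))
                   (sumTo-mono-≤ k (λ i i<k → ≤1 (suc i) (s<s i<k)))
    f0≡1 : f 0 ≡ 1
    f0≡1 = ≤-antisym (≤1 0 z<s)
             (+-cancelʳ-≤ k 1 (f 0) (≤-trans (≤-reflexive (sym total)) (+-monoʳ-≤ (f 0) rest≤k)))
    rest≡k : sumTo k (f ∘ suc) ≡ k
    rest≡k = +-cancelˡ-≡ 1 _ _ (trans (cong (_+ sumTo k (f ∘ suc)) (sym f0≡1)) total)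

sumList : {A : Set} → List A → (A → ℕ) → ℕ
sumList []       g = 0
sumList (x ∷ xs) g = g x + sumList xs g

sumList-map : ∀ {A B : Set} (f : A → B) xs g → sumList (map f xs) g ≡ sumList xs (g ∘ f)
sumList-map f []       g = refl
sumList-map f (x ∷ xs) g = cong (g (f x) +_) (sumList-map f xs g)

sumList-++ : ∀ {A : Set} (xs ys : List A) g → sumList (xs ++ ys) g ≡ sumList xs g + sumList ys g
sumList-++ []       ys g = refl
sumList-++ (x ∷ xs) ys g = trans (cong (g x +_) (sumList-++ xs ys g)) (sym (+-assoc (g x) _ _))

sumList-concatMap : ∀ {A B : Set} (f : A → List B) xs g →
  sumList (concatMap f xs) g ≡ sumList xs (λ x → sumList (f x) g)
sumList-concatMap f []       g = refl
sumList-concatMap f (x ∷ xs) g =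
  trans (sumList-++ (f x) (concatMap f xs) g) (cong (sumList (f x) g +_) (sumList-concatMap f xs g))

sumList-filter : ∀ {A : Set} (b : A → Bool) xs g →
  sumList (filter (λ x → Bool.T? (b x)) xs) g ≡ sumList xs (λ x → 𝟙 (b x) * g x)
sumList-filter b []       g = refl
sumList-filter b (x ∷ xs) g with b x
... | true  = cong₂ _+_ (sym (+-identityʳ (g x))) (sumList-filter b xs g)
... | false = sumList-filter b xs g

sumList-applyUpTo : ∀ {A : Set} k (f : ℕ → A) g → sumList (applyUpTo f k) g ≡ sumTo k (g ∘ f)
sumList-applyUpTo zero    f g = refl
sumList-applyUpTo (suc k) f g = cong (g (f 0) +_) (sumList-applyUpTo k (f ∘ suc) g)

sumList-oneTo : ∀ k g → sumList (oneTo k) g ≡ sumTo k (g ∘ suc)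
sumList-oneTo k g = trans (sumList-map suc (upTo k) g) (sumList-applyUpTo k (λ i → i) (g ∘ suc))

multiplicity : ℕ → List ℕ → ℕ
multiplicity h xs = sumList xs (λ x → 𝟙 (h ≡ᵇ x))

removeFirst : ℕ → List ℕ → List ℕ
removeFirst x []       = []
removeFirst x (y ∷ ys) with x ≟ y
... | yes _ = ys
... | no  _ = y ∷ removeFirst x ys

multiplicity-skip : ∀ {x y} ys → x ≢ y → 0 < multiplicity x (y ∷ ys) → 0 < multiplicity x ys
multiplicity-skip {x} {y} ys x≢y = subst (0 <_) (cong (λ b → 𝟙 b + multiplicity x ys) (dec-false (x ≟ y) x≢y))

removeFirst-↭ : ∀ x ys → 0 < multiplicity x ys → ys ↭ x ∷ removeFirst x ys
removeFirst-↭ x (y ∷ ys) pos with x ≟ y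
... | yes refl = ↭-refl
... | no  x≢y  = ↭-trans (prep y (removeFirst-↭ x ys (multiplicity-skip ys x≢y pos))) (swap y x ↭-refl)

multiplicity-removeFirst : ∀ x ys → 0 < multiplicity x ys →
  ∀ h → multiplicity h ys ≡ 𝟙 (h ≡ᵇ x) + multiplicity h (removeFirst x ys)
multiplicity-removeFirst x (y ∷ ys) pos h with x ≟ y
... | yes refl = refl
... | no  x≢y  = trans (cong (𝟙 (h ≡ᵇ y) +_) (multiplicity-removeFirst x ys (multiplicity-skip ys x≢y pos) h))
                       (+-left-comm (𝟙 (h ≡ᵇ y)) (𝟙 (h ≡ᵇ x)) _)

multiplicities⇒↭ : ∀ xs ys → (∀ h → multiplicity h xs ≡ multiplicity h ys) → xs ↭ ys
multiplicities⇒↭ []       []       same = ↭-refl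
multiplicities⇒↭ []       (y ∷ ys) same =
  ⊥-elim (0≢1+n (trans (same y) (cong (λ b → 𝟙 b + multiplicity y ys) (≡ᵇ-refl y))))
multiplicities⇒↭ (x ∷ xs) ys       same =
  ↭-trans (prep x (multiplicities⇒↭ xs (removeFirst x ys) same′)) (↭-sym (removeFirst-↭ x ys x∈ys))
  where
  x∈ys : 0 < multiplicity x ys
  x∈ys = subst (0 <_) (trans (sym (cong (λ b → 𝟙 b + multiplicity x xs) (≡ᵇ-refl x))) (same x)) z<s
  same′ : ∀ h → multiplicity h xs ≡ multiplicity h (removeFirst x ys)
  same′ h = +-cancelˡ-≡ (𝟙 (h ≡ᵇ x)) _ _ (trans (same h) (multiplicity-removeFirst x ys x∈ys h))

StrictlyDecreasingBelow : ℕ → (ℕ → ℕ) → Set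
StrictlyDecreasingBelow k f = ∀ i → suc i < k → f (suc i) < f i

elemᵇ-applyUpTo⁻ : ∀ k (f : ℕ → ℕ) x → elemᵇ x (applyUpTo f k) ≡ true → Σ[ i ∈ ℕ ] i < k × f i ≡ x
elemᵇ-applyUpTo⁻ (suc k) f x elem with x ≡ᵇ f 0 in x≡f0
... | true  = 0 , z<s , sym (≡ᵇ-true⇒≡ x (f 0) x≡f0)
... | false with elemᵇ-applyUpTo⁻ k (f ∘ suc) x elem
...   | i , i<k , fi≡x = suc i , s<s i<k , fi≡x

elemᵇ-applyUpTo-false : ∀ k (f : ℕ → ℕ) x → (∀ i → i < k → f i ≢ x) → elemᵇ x (applyUpTo f k) ≡ false
elemᵇ-applyUpTo-false k f x ∉ with elemᵇ x (applyUpTo f k) in elem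
... | false = refl
... | true with elemᵇ-applyUpTo⁻ k f x elem
...   | i , i<k , fi≡x = ⊥-elim (∉ i i<k fi≡x)

elemᵇ-applyUpTo-bounded : ∀ k (f : ℕ → ℕ) {M} x → (∀ i → i < k → f i < M) → M ≤ x →
  elemᵇ x (applyUpTo f k) ≡ false
elemᵇ-applyUpTo-bounded k f x bound M≤x =
  elemᵇ-applyUpTo-false k f x (λ i i<k fi≡x → <⇒≱ (bound i i<k) (subst (_ ≤_) (sym fi≡x) M≤x))

strictlyDecreasing⇒<head : ∀ k f → StrictlyDecreasingBelow k f → ∀ i → suc i < k → f (suc i) < f 0
strictlyDecreasing⇒<head k f dec zero    1<k  = dec 0 1<k
strictlyDecreasing⇒<head k f dec (suc i) si<k =
  <-trans (dec (suc i) si<k) (strictlyDecreasing⇒<head k f dec i (<-trans (n<1+n (suc i)) si<k))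

sumTo-image : ∀ k f {M} (Ψ : ℕ → ℕ) → StrictlyDecreasingBelow k f → (∀ i → i < k → f i < M) →
  sumTo k (Ψ ∘ f) ≡ sumTo M (λ x → 𝟙 (elemᵇ x (applyUpTo f k)) * Ψ x)
sumTo-image zero    f {M} Ψ dec bound = sym (sumTo-zero M (λ _ _ → refl))
sumTo-image (suc k) f {M} Ψ dec bound = begin
  Ψ (f 0) + sumTo k (Ψ ∘ f ∘ suc)
    ≡⟨ cong₂ _+_ (sym (sumTo-δ M (f 0) Ψ (λ M≤f0 → ⊥-elim (<⇒≱ (bound 0 z<s) M≤f0))))
                 (sumTo-image k (f ∘ suc) Ψ (λ i si<k → dec (suc i) (s<s si<k)) (λ i i<k → bound (suc i) (s<s i<k))) ⟩
  sumTo M (λ x → 𝟙 (x ≡ᵇ f 0) * Ψ x) + sumTo M (λ x → 𝟙 (inTail x) * Ψ x)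
    ≡⟨ sym (sumTo-distrib M _ _) ⟩
  sumTo M (λ x → 𝟙 (x ≡ᵇ f 0) * Ψ x + 𝟙 (inTail x) * Ψ x)
    ≡⟨ sumTo-cong M (λ x _ → disjoint-union x) ⟩
  sumTo M (λ x → 𝟙 ((x ≡ᵇ f 0) ∨ inTail x) * Ψ x) ∎
  where
  open ≡-Reasoning
  inTail : ℕ → Bool
  inTail x = elemᵇ x (applyUpTo (f ∘ suc) k)
  head∉tail : inTail (f 0) ≡ false
  head∉tail = elemᵇ-applyUpTo-false k (f ∘ suc) (f 0)
    (λ i i<k → <⇒≢ (strictlyDecreasing⇒<head (suc k) f dec i (s<s i<k)))
  disjoint-union : ∀ x → 𝟙 (x ≡ᵇ f 0) * Ψ x + 𝟙 (inTail x) * Ψ x ≡ 𝟙 ((x ≡ᵇ f 0) ∨ inTail x) * Ψ x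
  disjoint-union x with x ≡ᵇ f 0 in x≡f0
  ... | false = refl
  ... | true rewrite ≡ᵇ-true⇒≡ x (f 0) x≡f0 | head∉tail = +-identityʳ _

sumTo-image-count : ∀ k f {M} → StrictlyDecreasingBelow k f → (∀ i → i < k → f i < M) →
  sumTo M (λ x → 𝟙 (elemᵇ x (applyUpTo f k))) ≡ k
sumTo-image-count k f {M} dec bound = begin
  sumTo M (λ x → 𝟙 (elemᵇ x (applyUpTo f k)))      ≡⟨ sumTo-cong M (λ x _ → sym (*-identityʳ _)) ⟩
  sumTo M (λ x → 𝟙 (elemᵇ x (applyUpTo f k)) * 1)  ≡⟨ sym (sumTo-image k f (λ _ → 1) dec bound) ⟩
  sumTo k (λ _ → 1)                                ≡⟨ sumTo-ones k (λ _ _ → refl) ⟩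
  k                                                ∎
  where open ≡-Reasoning

-- Given a ≤ b and c ≤ d, the first summand equals (b − a)(d − c); this is that product expanded without subtraction.
crossing-identity : ∀ {a b c d} → a Bool.≤ b → c Bool.≤ d →
  𝟙 (d ∧ not c ∧ not a ∧ b) + 𝟙 (d ∧ a) + 𝟙 (c ∧ b) ≡ 𝟙 (d ∧ b) + 𝟙 (c ∧ a)
crossing-identity f≤t         f≤t         = refl
crossing-identity f≤t         (b≤b {false}) = refl
crossing-identity f≤t         (b≤b {true})  = refl
crossing-identity (b≤b {false}) f≤t         = refl
crossing-identity (b≤b {false}) (b≤b {false}) = refl
crossing-identity (b≤b {false}) (b≤b {true})  = refl
crossing-identity (b≤b {true})  f≤t         = refl
crossing-identity (b≤b {true})  (b≤b {false}) = refl
crossing-identity (b≤b {true})  (b≤b {true})  = refl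

module Abacus (α : ℕ → Bool) where

  Closed∸ : ℕ → Set
  Closed∸ n = ∀ z → α (z + n) Bool.≤ α z

  -- Whether position x − e carries a bead, every negative position counting as a bead.
  beadAt∸ : ℕ → ℕ → Bool
  beadAt∸ x e = does (x <? e) ∨ α (x ∸ e)

  beadAt∸-< : ∀ {x e} → x < e → beadAt∸ x e ≡ true
  beadAt∸-< {x} {e} x<e = cong (_∨ α (x ∸ e)) (dec-true (x <? e) x<e)

  beadAt∸-≥ : ∀ {x e} → e ≤ x → beadAt∸ x e ≡ α (x ∸ e)
  beadAt∸-≥ {x} {e} e≤x = cong (_∨ α (x ∸ e)) (dec-false (x <? e) (≤⇒≯ e≤x))

  beadAt∸-shift : ∀ n x e → beadAt∸ (n + x) (n + e) ≡ beadAt∸ x e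
  beadAt∸-shift n x e = cong₂ _∨_
    (does-⇔ (mk⇔ (+-cancelˡ-< n x e) (+-monoʳ-< n)) (n + x <? n + e) (x <? e))
    (cong α ([m+n]∸[m+o]≡n∸o n x e))

  beadAt∸-mono : ∀ {p} → Closed∸ p → ∀ x h → beadAt∸ x h Bool.≤ beadAt∸ x (h + p)
  beadAt∸-mono {p} closed x h with x <? h | x <? h + p
  ... | yes x<h | _ rewrite beadAt∸-< x<h | beadAt∸-< (<-≤-trans x<h (m≤m+n h p)) = b≤b
  ... | no x≮h | yes x<h+p rewrite beadAt∸-< x<h+p = ≤-maximum _
  ... | no x≮h | no x≮h+p rewrite beadAt∸-≥ (≮⇒≥ x≮h) | beadAt∸-≥ (≮⇒≥ x≮h+p) =
    subst (λ y → α y Bool.≤ α (x ∸ (h + p))) shifted (closed (x ∸ (h + p)))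
    where
    shifted : x ∸ (h + p) + p ≡ x ∸ h
    shifted = begin
      x ∸ (h + p) + p  ≡⟨ cong (_+ p) (sym (∸-+-assoc x h p)) ⟩
      x ∸ h ∸ p + p    ≡⟨ m∸n+n≡m (subst (_≤ x ∸ h) (m+n∸m≡n h p) (∸-monoˡ-≤ h (≮⇒≥ x≮h+p))) ⟩
      x ∸ h            ∎
      where open ≡-Reasoning

  module Bounded {M : ℕ} (bounded : ∀ z → M ≤ z → α z ≡ false) where

    crossings : ℕ → ℕ → ℕ → ℕ
    crossings n p h = sumTo M (λ x → 𝟙 (α x ∧ not (α (x + n)) ∧ not (beadAt∸ x h) ∧ beadAt∸ x (h + p)))

    correlation : ℕ → ℕ
    correlation e = sumTo M (λ x → 𝟙 (α x ∧ beadAt∸ x e))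

    shifted-correlation : ∀ n e →
      sumTo M (λ x → 𝟙 (α (x + n) ∧ beadAt∸ x e)) + sumTo n (𝟙 ∘ α) ≡ correlation (n + e)
    shifted-correlation n e = begin
      sumTo M (λ x → 𝟙 (α (x + n) ∧ beadAt∸ x e)) + sumTo n (𝟙 ∘ α)
        ≡⟨ +-comm _ (sumTo n (𝟙 ∘ α)) ⟩
      sumTo n (𝟙 ∘ α) + sumTo M (λ x → 𝟙 (α (x + n) ∧ beadAt∸ x e))
        ≡⟨ cong₂ _+_ (sumTo-cong n (λ y y<n → cong 𝟙 (below y y<n)))
                     (sumTo-cong M (λ x _ → cong 𝟙 (cong₂ _∧_ (cong α (+-comm x n)) (sym (beadAt∸-shift n x e))))) ⟩
      sumTo n g + sumTo M (λ x → g (n + x))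
        ≡⟨ sym (sumTo-+ n M g) ⟩
      sumTo (n + M) g
        ≡⟨ sumTo-vanishing g (λ y M≤y _ → cong (λ b → 𝟙 (b ∧ beadAt∸ y (n + e))) (bounded y M≤y)) (m≤n+m M n) ⟩
      correlation (n + e) ∎
      where
      open ≡-Reasoning
      g : ℕ → ℕ
      g y = 𝟙 (α y ∧ beadAt∸ y (n + e))
      below : ∀ y → y < n → α y ≡ α y ∧ beadAt∸ y (n + e)
      below y y<n = trans (sym (∧-identityʳ (α y))) (cong (α y ∧_) (sym (beadAt∸-< (<-≤-trans y<n (m≤m+n n e)))))

    crossings-via-correlations : ∀ {n p} → Closed∸ n → Closed∸ p → ∀ h →
      crossings n p h + correlation h + correlation (n + (h + p)) ≡ correlation (h + p) + correlation (n + h)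
    crossings-via-correlations {n} {p} closedₙ closedₚ h = begin
      crossings n p h + correlation h + correlation (n + (h + p))
        ≡⟨ cong (crossings n p h + correlation h +_) (sym (shifted-correlation n (h + p))) ⟩
      crossings n p h + correlation h + (sumTo M Cb + K)
        ≡⟨ sym (+-assoc (crossings n p h + correlation h) (sumTo M Cb) K) ⟩
      crossings n p h + correlation h + sumTo M Cb + K
        ≡⟨ cong (_+ K) (trans (cong (_+ sumTo M Cb) (sym (sumTo-distrib M T Da))) (sym (sumTo-distrib M _ Cb))) ⟩
      sumTo M (λ x → T x + Da x + Cb x) + K
        ≡⟨ cong (_+ K) (sumTo-cong M (λ x _ → crossing-identity (beadAt∸-mono closedₚ x h) (closedₙ x))) ⟩
      sumTo M (λ x → Db x + Ca x) + K
        ≡⟨ cong (_+ K) (sumTo-distrib M Db Ca) ⟩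
      correlation (h + p) + sumTo M Ca + K
        ≡⟨ +-assoc (correlation (h + p)) (sumTo M Ca) K ⟩
      correlation (h + p) + (sumTo M Ca + K)
        ≡⟨ cong (correlation (h + p) +_) (shifted-correlation n h) ⟩
      correlation (h + p) + correlation (n + h) ∎
      where
      open ≡-Reasoning
      K : ℕ
      K = sumTo n (𝟙 ∘ α)
      T Da Db Ca Cb : ℕ → ℕ
      T  x = 𝟙 (α x ∧ not (α (x + n)) ∧ not (beadAt∸ x h) ∧ beadAt∸ x (h + p))
      Da x = 𝟙 (α x ∧ beadAt∸ x h)
      Db x = 𝟙 (α x ∧ beadAt∸ x (h + p))
      Ca x = 𝟙 (α (x + n) ∧ beadAt∸ x h)
      Cb x = 𝟙 (α (x + n) ∧ beadAt∸ x (h + p))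

    crossings-symmetric : ∀ {n p} → Closed∸ n → Closed∸ p → ∀ h → crossings n p h ≡ crossings p n h
    crossings-symmetric {n} {p} closedₙ closedₚ h = +-cancelʳ-≡ (correlation h + correlation (n + (h + p))) _ _ (begin
      crossings n p h + (correlation h + correlation (n + (h + p)))
        ≡⟨ sym (+-assoc (crossings n p h) _ _) ⟩
      crossings n p h + correlation h + correlation (n + (h + p))
        ≡⟨ crossings-via-correlations closedₙ closedₚ h ⟩
      correlation (h + p) + correlation (n + h)
        ≡⟨ +-comm (correlation (h + p)) _ ⟩
      correlation (n + h) + correlation (h + p)
        ≡⟨ cong₂ (λ u v → correlation u + correlation v) (+-comm n h) (+-comm h p) ⟩
      correlation (h + n) + correlation (p + h)
        ≡⟨ sym (crossings-via-correlations closedₚ closedₙ h) ⟩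
      crossings p n h + correlation h + correlation (p + (h + n))
        ≡⟨ cong (λ u → crossings p n h + correlation h + correlation u) (shuffle p h n) ⟩
      crossings p n h + correlation h + correlation (n + (h + p))
        ≡⟨ +-assoc (crossings p n h) _ _ ⟩
      crossings p n h + (correlation h + correlation (n + (h + p))) ∎)
      where
      open ≡-Reasoning
      shuffle : ∀ p h n → p + (h + n) ≡ n + (h + p)
      shuffle = solve-∀

≤ᵇ-true⇒≤ : ∀ {m n} → (m ≤ᵇ n) ≡ true → m ≤ n
≤ᵇ-true⇒≤ {m} {n} eq = ≤ᵇ⇒≤ m n (subst Bool.T (sym eq) _)

≤ᵇ-false⇒> : ∀ {m n} → (m ≤ᵇ n) ≡ false → n < m
≤ᵇ-false⇒> eq = ≰⇒> (λ m≤n → subst Bool.T eq (≤⇒≤ᵇ m≤n))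

conjugate : List ℕ → ℕ → ℕ
conjugate xs j = length (filter (λ k → j ≤? k) xs)

partAt-≤-head : ∀ {x xs} → Linked _≥_ (x ∷ xs) → ∀ i → partAt (x ∷ xs) i ≤ x
partAt-≤-head _ zero       = z≤n
partAt-≤-head _ (suc zero) = ≤-refl
partAt-≤-head {xs = []}    _           (suc (suc i)) = z≤n
partAt-≤-head {xs = _ ∷ _} (x≥y ∷ dec) (suc (suc i)) = ≤-trans (partAt-≤-head dec (suc i)) x≥y

partAt-antitone : ∀ {xs} → Linked _≥_ xs → ∀ i → partAt xs (suc (suc i)) ≤ partAt xs (suc i)
partAt-antitone {[]}         _           i       = z≤n
partAt-antitone {_ ∷ []}     _           i       = z≤n
partAt-antitone {_ ∷ _ ∷ _}  (x≥y ∷ dec) zero    = x≥y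
partAt-antitone {_ ∷ _ ∷ _}  (x≥y ∷ dec) (suc i) = partAt-antitone dec i

conjugate-vanishes : ∀ {x xs j} → Linked _≥_ (x ∷ xs) → x < j → conjugate xs j ≡ 0
conjugate-vanishes {xs = []}     _           x<j = refl
conjugate-vanishes {xs = y ∷ ys} {j} (x≥y ∷ dec) x<j with j ≤ᵇ y in j≤y
... | true  = ⊥-elim (<⇒≱ x<j (≤-trans (≤ᵇ-true⇒≤ j≤y) x≥y))
... | false = conjugate-vanishes dec (≤-<-trans x≥y x<j)

≤conjugate⇒≤partAt : ∀ {xs} → Linked _≥_ xs → ∀ i j → suc i ≤ conjugate xs j → j ≤ partAt xs (suc i)
≤conjugate⇒≤partAt {x ∷ xs} dec i j le with j ≤ᵇ x in j≤x
≤conjugate⇒≤partAt {x ∷ xs} dec zero    j le        | true = ≤ᵇ-true⇒≤ j≤x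
≤conjugate⇒≤partAt {x ∷ xs} dec (suc i) j (s≤s le) | true = ≤conjugate⇒≤partAt (Linked.tail dec) i j le
≤conjugate⇒≤partAt {x ∷ xs} dec i j le | false =
  ⊥-elim (≤⇒≯ (subst (suc i ≤_) (conjugate-vanishes dec (≤ᵇ-false⇒> j≤x)) le) z<s)

≤partAt⇒≤conjugate : ∀ {xs} → Linked _≥_ xs → ∀ i j → 1 ≤ j → j ≤ partAt xs (suc i) → suc i ≤ conjugate xs j
≤partAt⇒≤conjugate {[]}     _   i (suc j) _ ()
≤partAt⇒≤conjugate {x ∷ xs} dec i j 1≤j le with j ≤ᵇ x in j≤x
≤partAt⇒≤conjugate {x ∷ xs} dec zero    j 1≤j le | true = s≤s z≤n
≤partAt⇒≤conjugate {x ∷ xs} dec (suc i) j 1≤j le | true = s≤s (≤partAt⇒≤conjugate (Linked.tail dec) i j 1≤j le)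
... | false = ⊥-elim (<⇒≱ (≤ᵇ-false⇒> j≤x) (≤-trans le (partAt-≤-head dec (suc i))))

conjugate-antitone : ∀ xs {j j′} → j ≤ j′ → conjugate xs j′ ≤ conjugate xs j
conjugate-antitone []       j≤j′ = z≤n
conjugate-antitone (x ∷ xs) {j} {j′} j≤j′ with j′ ≤ᵇ x in j′≤x | j ≤ᵇ x in j≤x
... | true  | true  = s≤s (conjugate-antitone xs j≤j′)
... | true  | false = ⊥-elim (<⇒≱ (≤ᵇ-false⇒> j≤x) (≤-trans j≤j′ (≤ᵇ-true⇒≤ j′≤x)))
... | false | true  = m≤n⇒m≤1+n (conjugate-antitone xs j≤j′)
... | false | false = conjugate-antitone xs j≤j′

conjugate-1 : ∀ {xs} → All (1 ≤_) xs → conjugate xs 1 ≡ length xs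
conjugate-1 {[]}     []          = refl
conjugate-1 {x ∷ xs} (1≤x ∷ pos) with 1 ≤ᵇ x in 1≤ᵇx
... | true  = cong suc (conjugate-1 pos)
... | false = ⊥-elim (<⇒≱ (≤ᵇ-false⇒> 1≤ᵇx) 1≤x)

hook-arith : ∀ {R C i j} → j ≤ R → i ≤ C → (R ∸ j) + (C ∸ i) + 1 + (i + j) ≡ R + C + 1
hook-arith {R} {C} {i} {j} j≤R i≤C = begin
  (R ∸ j) + (C ∸ i) + 1 + (i + j)  ≡⟨ shuffle (R ∸ j) (C ∸ i) i j ⟩
  (R ∸ j + j) + (C ∸ i + i) + 1    ≡⟨ cong₂ (λ x y → x + y + 1) (m∸n+n≡m j≤R) (m∸n+n≡m i≤C) ⟩
  R + C + 1                        ∎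
  where
  open ≡-Reasoning
  shuffle : ∀ x y i j → x + y + 1 + (i + j) ≡ (x + j) + (y + i) + 1
  shuffle = solve-∀

cell∈cells : ∀ κ {i j} → i < len κ → j < row κ (suc i) → (suc i , suc j) ∈ cells κ
cell∈cells κ {i} {j} i<ℓ j<λᵢ =
  ∈-concatMap⁺ rowCells (lose {P = λ i′ → (suc i , suc j) ∈ rowCells i′}
    (∈-map⁺ suc (∈-upTo⁺ i<ℓ)) (∈-map⁺ (suc i ,_) (∈-map⁺ suc (∈-upTo⁺ j<λᵢ))))
  where
  rowCells : ℕ → List (ℕ × ℕ)
  rowCells i′ = map (i′ ,_) (oneTo (row κ i′))

multiplicity-Hnp≡sum : ∀ n p h κ → multiplicity h (Hnp n p κ) ≡
  sumTo (len κ) (λ i → sumTo (row κ (suc i)) (λ j →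
    𝟙 (isRowᵇ n κ (suc i) ∧ isColᵇ p κ (suc j)) * 𝟙 (h ≡ᵇ hook κ (suc i , suc j))))
multiplicity-Hnp≡sum n p h κ = begin
  multiplicity h (Hnp n p κ)
    ≡⟨ sumList-map (hook κ) (filter (λ c → Bool.T? (inRowCol c)) (cells κ)) _ ⟩
  sumList (filter (λ c → Bool.T? (inRowCol c)) (cells κ)) (λ c → 𝟙 (h ≡ᵇ hook κ c))
    ≡⟨ sumList-filter inRowCol (cells κ) _ ⟩
  sumList (cells κ) G
    ≡⟨ sumList-concatMap rowCells (oneTo (len κ)) G ⟩
  sumList (oneTo (len κ)) (λ i → sumList (rowCells i) G)
    ≡⟨ sumList-oneTo (len κ) _ ⟩
  sumTo (len κ) (λ i → sumList (rowCells (suc i)) G)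
    ≡⟨ sumTo-cong (len κ) (λ i _ →
         trans (sumList-map (suc i ,_) (oneTo (row κ (suc i))) G) (sumList-oneTo (row κ (suc i)) _)) ⟩
  sumTo (len κ) (λ i → sumTo (row κ (suc i)) (λ j → G (suc i , suc j))) ∎
  where
  open ≡-Reasoning
  inRowCol : ℕ × ℕ → Bool
  inRowCol (i , j) = isRowᵇ n κ i ∧ isColᵇ p κ j
  G : ℕ × ℕ → ℕ
  G c = 𝟙 (inRowCol c) * 𝟙 (h ≡ᵇ hook κ c)
  rowCells : ℕ → List (ℕ × ℕ)
  rowCells i = map (i ,_) (oneTo (row κ i))

module Geometry (r : ℕ) (rs : List ℕ) (dec : Linked _≥_ (r ∷ rs)) (pos : All (1 ≤_) (r ∷ rs)) where

  κ : Partition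
  κ = mkPartition (r ∷ rs) dec pos

  ℓ m : ℕ
  ℓ = len κ
  m = hook κ (1 , 1)

  a b : ℕ → ℕ
  a i = hook κ (suc i , 1)
  b j = hook κ (1 , suc j)

  α β : ℕ → Bool
  α x = elemᵇ x (Hc κ)
  β y = elemᵇ y (Hr κ)

  open Abacus α

  conj-1 : conj κ 1 ≡ ℓ
  conj-1 = conjugate-1 pos

  row≤r : ∀ i → row κ i ≤ r
  row≤r = partAt-≤-head dec

  cell⇒≤conj : ∀ {i j} → suc j ≤ row κ (suc i) → suc i ≤ conj κ (suc j)
  cell⇒≤conj {i} {j} = ≤partAt⇒≤conjugate dec i (suc j) (s≤s z≤n)

  hook-cell : ∀ i j → suc j ≤ row κ (suc i) →
    hook κ (suc i , suc j) + (suc i + suc j) ≡ row κ (suc i) + conj κ (suc j) + 1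
  hook-cell i j cell = hook-arith cell (cell⇒≤conj cell)

  row-positive : ∀ {i} → i < ℓ → 1 ≤ row κ (suc i)
  row-positive {i} i<ℓ = ≤conjugate⇒≤partAt dec i 1 (subst (suc i ≤_) (sym conj-1) i<ℓ)

  corner-identity : ∀ {i j} → i < ℓ → j < r →
    a i + b j + (suc i + suc j) ≡ row κ (suc i) + conj κ (suc j) + 1 + m
  corner-identity {i} {j} i<ℓ j<r = +-cancelʳ-≡ 2 _ _ (begin
    a i + b j + (suc i + suc j) + 2                  ≡⟨ shuffle₁ (a i) (b j) i j ⟩
    (a i + (suc i + 1)) + (b j + (1 + suc j))        ≡⟨ cong₂ _+_ (hook-cell i 0 (row-positive i<ℓ)) (hook-cell 0 j j<r) ⟩
    (L + conj κ 1 + 1) + (r + C + 1)                 ≡⟨ shuffle₂ L (conj κ 1) r C ⟩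
    (L + C + 1) + (r + conj κ 1 + 1)                 ≡⟨ cong ((L + C + 1) +_) (sym (hook-cell 0 0 (row-positive {0} z<s))) ⟩
    (L + C + 1) + (m + (1 + 1))                      ≡⟨ sym (+-assoc (L + C + 1) m 2) ⟩
    L + C + 1 + m + 2                                ∎)
    where
    open ≡-Reasoning
    L C : ℕ
    L = row κ (suc i)
    C = conj κ (suc j)
    shuffle₁ : ∀ a b i j → a + b + (suc i + suc j) + 2 ≡ (a + (suc i + 1)) + (b + (1 + suc j))
    shuffle₁ = solve-∀
    shuffle₂ : ∀ L c r C → (L + c + 1) + (r + C + 1) ≡ (L + C + 1) + (r + c + 1)
    shuffle₂ = solve-∀

  cell-corner : ∀ {i j} → i < ℓ → suc j ≤ row κ (suc i) → a i + b j ≡ hook κ (suc i , suc j) + m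
  cell-corner {i} {j} i<ℓ cell = +-cancelʳ-≡ (suc i + suc j) _ _ (begin
    a i + b j + (suc i + suc j)                            ≡⟨ corner-identity i<ℓ (≤-trans cell (row≤r (suc i))) ⟩
    row κ (suc i) + conj κ (suc j) + 1 + m                 ≡⟨ cong (_+ m) (sym (hook-cell i j cell)) ⟩
    hook κ (suc i , suc j) + (suc i + suc j) + m           ≡⟨ +-right-comm (hook κ (suc i , suc j)) _ m ⟩
    hook κ (suc i , suc j) + m + (suc i + suc j)           ∎)
    where open ≡-Reasoning

  non-cell-corner : ∀ {i j} → i < ℓ → j < r → row κ (suc i) < suc j → a i + b j < m
  non-cell-corner {i} {j} i<ℓ j<r non-cell = +-cancelʳ-< (suc i + suc j) (a i + b j) m (begin-strict
    a i + b j + (suc i + suc j)                ≡⟨ corner-identity i<ℓ j<r ⟩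
    row κ (suc i) + conj κ (suc j) + 1 + m     <⟨ +-monoˡ-< m outside ⟩
    suc i + suc j + m                          ≡⟨ +-comm (suc i + suc j) m ⟩
    m + (suc i + suc j)                        ∎)
    where
    open ≤-Reasoning
    conj<i : conj κ (suc j) < suc i
    conj<i = ≰⇒> (λ i≤conj → <⇒≱ non-cell (≤conjugate⇒≤partAt dec i (suc j) i≤conj))
    outside : row κ (suc i) + conj κ (suc j) + 1 < suc i + suc j
    outside = ≤-trans (≤-reflexive (shuffle (row κ (suc i)) (conj κ (suc j)))) (+-mono-≤ conj<i non-cell)
      where
      shuffle : ∀ L C → suc (L + C + 1) ≡ suc C + suc L
      shuffle = solve-∀

  corner-split : ∀ {i j k} → i < ℓ → j < r → a i + b j ≡ m + k →
    suc j ≤ row κ (suc i) × hook κ (suc i , suc j) ≡ k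
  corner-split {i} {j} {k} i<ℓ j<r corner with suc j ≤? row κ (suc i)
  ... | no ¬cell = ⊥-elim (<⇒≱ (non-cell-corner i<ℓ j<r (≰⇒> ¬cell)) (subst (m ≤_) (sym corner) (m≤m+n m k)))
  ... | yes cell = cell , +-cancelʳ-≡ m _ _ (trans (sym (cell-corner i<ℓ cell)) (trans corner (+-comm m k)))

  a≤m : ∀ i → a i ≤ m
  a≤m i = +-monoˡ-≤ 1 (+-mono-≤ (∸-monoˡ-≤ 1 (row≤r (suc i))) (∸-monoʳ-≤ (conj κ 1) (s≤s z≤n)))

  b≤m : ∀ j → b j ≤ m
  b≤m j = +-monoˡ-≤ 1 (+-mono-≤ (∸-monoʳ-≤ r (s≤s z≤n)) (∸-monoˡ-≤ 1 (conjugate-antitone (r ∷ rs) (s≤s z≤n))))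

  a-decreasing : StrictlyDecreasingBelow ℓ a
  a-decreasing i si<ℓ = +-monoˡ-< 1 (+-mono-≤-<
    (∸-monoˡ-≤ 1 (partAt-antitone dec i))
    (∸-monoʳ-< (n<1+n (suc i)) (subst (suc (suc i) ≤_) (sym conj-1) si<ℓ)))

  b-decreasing : StrictlyDecreasingBelow r b
  b-decreasing j sj<r = +-monoˡ-< 1 (+-mono-<-≤
    (∸-monoʳ-< (n<1+n (suc j)) sj<r)
    (∸-monoˡ-≤ 1 (conjugate-antitone (r ∷ rs) (n≤1+n (suc j)))))

  Hc≡ : Hc κ ≡ applyUpTo a ℓ
  Hc≡ = trans (cong (map (λ i → hook κ (i , 1))) (map-upTo suc ℓ)) (map-applyUpTo suc (λ i → hook κ (i , 1)) ℓ)

  Hr≡ : Hr κ ≡ applyUpTo b r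
  Hr≡ = trans (cong (map (λ j → hook κ (1 , j))) (map-upTo suc r)) (map-applyUpTo suc (λ j → hook κ (1 , j)) r)

  α-bounded : ∀ z → suc m ≤ z → α z ≡ false
  α-bounded z m<z = trans (cong (elemᵇ z) Hc≡) (elemᵇ-applyUpTo-bounded ℓ a z (λ i _ → s≤s (a≤m i)) m<z)

  β-bounded : ∀ y → suc m ≤ y → β y ≡ false
  β-bounded y m<y = trans (cong (elemᵇ y) Hr≡) (elemᵇ-applyUpTo-bounded r b y (λ j _ → s≤s (b≤m j)) m<y)

  α⁻ : ∀ {z} → α z ≡ true → Σ[ i ∈ ℕ ] i < ℓ × a i ≡ z
  α⁻ {z} αz = elemᵇ-applyUpTo⁻ ℓ a z (trans (sym (cong (elemᵇ z) Hc≡)) αz)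

  β⁻ : ∀ {y} → β y ≡ true → Σ[ j ∈ ℕ ] j < r × b j ≡ y
  β⁻ {y} βy = elemᵇ-applyUpTo⁻ r b y (trans (sym (cong (elemᵇ y) Hr≡)) βy)

  α-count : sumTo (suc m) (𝟙 ∘ α) ≡ ℓ
  α-count = trans (sumTo-cong (suc m) {𝟙 ∘ α} (λ x _ → cong (𝟙 ∘ elemᵇ x) Hc≡))
                  (sumTo-image-count ℓ a a-decreasing (λ i _ → s≤s (a≤m i)))

  β-count : sumTo (suc m) (𝟙 ∘ β) ≡ r
  β-count = trans (sumTo-cong (suc m) {𝟙 ∘ β} (λ y _ → cong (𝟙 ∘ elemᵇ y) Hr≡))
                  (sumTo-image-count r b b-decreasing (λ j _ → s≤s (b≤m j)))

  m+1≡r+ℓ : suc m ≡ r + ℓ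
  m+1≡r+ℓ = +-cancelʳ-≡ 1 _ _ (trans (sym (+-suc m 1))
    (trans (hook-cell 0 0 (row-positive {0} z<s)) (cong (λ c → r + c + 1) conj-1)))

  α-β-disjoint : ∀ {z} → z ≤ m → α z ≡ true → β (m ∸ z) ≡ true → ⊥
  α-β-disjoint {z} z≤m αz βm∸z with α⁻ {z} αz | β⁻ {m ∸ z} βm∸z
  ... | i , i<ℓ , ai≡z | j , j<r , bj≡m∸z =
    1+n≢0 (trans (+-comm 1 _) (proj₂ (corner-split i<ℓ j<r corner)))
    where
    corner : a i + b j ≡ m + 0
    corner = trans (cong₂ _+_ ai≡z bj≡m∸z) (trans (m+[n∸m]≡n z≤m) (sym (+-identityʳ m)))

  -- H^c and m − H^r are disjoint by corner-split and their sizes ℓ and r add up to m + 1, so they partition [0, m].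
  β-complement : ∀ {z} → z ≤ m → β (m ∸ z) ≡ not (α z)
  β-complement {z} z≤m = 𝟙+𝟙≡1⇒≡not (α z) (β (m ∸ z)) (sumTo-saturated (suc m) at-most-one total z (s≤s z≤m))
    where
    open ≡-Reasoning
    at-most-one : ∀ x → x < suc m → 𝟙 (α x) + 𝟙 (β (m ∸ x)) ≤ 1
    at-most-one x x<m+1 = 𝟙-disjoint (α x) (β (m ∸ x)) (α-β-disjoint (≤-pred x<m+1))
    total : sumTo (suc m) (λ x → 𝟙 (α x) + 𝟙 (β (m ∸ x))) ≡ suc m
    total = begin
      sumTo (suc m) (λ x → 𝟙 (α x) + 𝟙 (β (m ∸ x)))
        ≡⟨ sumTo-distrib (suc m) (𝟙 ∘ α) (𝟙 ∘ β ∘ (m ∸_)) ⟩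
      sumTo (suc m) (𝟙 ∘ α) + sumTo (suc m) (𝟙 ∘ β ∘ (m ∸_))
        ≡⟨ cong₂ _+_ α-count (trans (sumTo-reverse m (𝟙 ∘ β)) β-count) ⟩
      ℓ + r
        ≡⟨ trans (+-comm ℓ r) (sym m+1≡r+ℓ) ⟩
      suc m ∎

  β-beadAt∸ : ∀ {x} e → x ≤ m → β (m + e ∸ x) ≡ not (beadAt∸ x e)
  β-beadAt∸ {x} e x≤m with x <? e
  ... | yes x<e rewrite beadAt∸-< x<e = β-bounded (m + e ∸ x) (begin
    suc m             ≡⟨ +-comm 1 m ⟩
    m + 1             ≤⟨ +-monoʳ-≤ m (m<n⇒0<n∸m x<e) ⟩
    m + (e ∸ x)       ≡⟨ sym (+-∸-assoc m (<⇒≤ x<e)) ⟩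
    m + e ∸ x         ∎)
    where open ≤-Reasoning
  ... | no x≮e rewrite beadAt∸-≥ (≮⇒≥ x≮e) =
    trans (cong β reflected) (β-complement (≤-trans (m∸n≤m x e) x≤m))
    where
    open ≡-Reasoning
    reflected : m + e ∸ x ≡ m ∸ (x ∸ e)
    reflected = begin
      m + e ∸ x              ≡⟨ cong (m + e ∸_) (sym (m+[n∸m]≡n (≮⇒≥ x≮e))) ⟩
      m + e ∸ (e + (x ∸ e))  ≡⟨ cong (_∸ (e + (x ∸ e))) (+-comm m e) ⟩
      e + m ∸ (e + (x ∸ e))  ≡⟨ [m+n]∸[m+o]≡n∸o e m (x ∸ e) ⟩
      m ∸ (x ∸ e)            ∎

  a≡z+k⇒z≤m : ∀ {z k} i → a i ≡ z + k → z ≤ m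
  a≡z+k⇒z≤m {z} {k} i ai≡z+k = ≤-trans (m≤m+n z k) (subst (_≤ m) ai≡z+k (a≤m i))

  core⇒closed : ∀ {k} → IsCore k κ → Closed∸ k
  core⇒closed {k} core z with α z in αz | α (z + k) in αz+k
  ... | true  | _     = ≤-maximum _
  ... | false | false = b≤b
  ... | false | true  with α⁻ {z + k} αz+k
  ...   | i , i<ℓ , ai≡z+k with β⁻ {m ∸ z} (trans (β-complement (a≡z+k⇒z≤m {z} {k} i ai≡z+k)) (cong not αz))
  ...     | j , j<r , bj≡m∸z = ⊥-elim (core _ (cell∈cells κ i<ℓ (proj₁ split)) (proj₂ split))
    where
    split : suc j ≤ row κ (suc i) × hook κ (suc i , suc j) ≡ k
    split = corner-split i<ℓ j<r (begin
      a i + b j            ≡⟨ cong₂ _+_ ai≡z+k bj≡m∸z ⟩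
      z + k + (m ∸ z)      ≡⟨ +-right-comm z k (m ∸ z) ⟩
      z + (m ∸ z) + k      ≡⟨ cong (_+ k) (m+[n∸m]≡n (a≡z+k⇒z≤m {z} {k} i ai≡z+k)) ⟩
      m + k                ∎)
      where open ≡-Reasoning
  open Bounded α-bounded

  column-sum : ∀ p h {x} → x ≤ m →
    sumTo r (λ j → 𝟙 (not (β (b j + p))) * 𝟙 (x + b j ≡ᵇ m + h))
      ≡ 𝟙 (not (beadAt∸ x h) ∧ beadAt∸ x (h + p))
  column-sum p h {x} x≤m = begin
    sumTo r (G ∘ b)
      ≡⟨ sumTo-image r b G b-decreasing (λ j _ → s≤s (b≤m j)) ⟩
    sumTo (suc m) (λ y → 𝟙 (elemᵇ y (applyUpTo b r)) * G y)
      ≡⟨ sumTo-cong (suc m) (λ y _ → only-c y) ⟩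
    sumTo (suc m) (λ y → 𝟙 (y ≡ᵇ c) * (𝟙 (β y) * 𝟙 (not (β (y + p)))))
      ≡⟨ sumTo-δ (suc m) c (λ y → 𝟙 (β y) * 𝟙 (not (β (y + p))))
                 (λ m<c → cong (λ t → 𝟙 t * 𝟙 (not (β (c + p)))) (β-bounded c m<c)) ⟩
    𝟙 (β c) * 𝟙 (not (β (c + p)))
      ≡⟨ cong₂ (λ u v → 𝟙 u * 𝟙 (not v)) (β-beadAt∸ h x≤m) (trans (cong β c+p≡) (β-beadAt∸ (h + p) x≤m)) ⟩
    𝟙 (not (beadAt∸ x h)) * 𝟙 (not (not (beadAt∸ x (h + p))))
      ≡⟨ cong (λ t → 𝟙 (not (beadAt∸ x h)) * 𝟙 t) (not-involutive _) ⟩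
    𝟙 (not (beadAt∸ x h)) * 𝟙 (beadAt∸ x (h + p))
      ≡⟨ 𝟙-∧ (not (beadAt∸ x h)) (beadAt∸ x (h + p)) ⟨
    𝟙 (not (beadAt∸ x h) ∧ beadAt∸ x (h + p)) ∎
    where
    open ≡-Reasoning
    c : ℕ
    c = m + h ∸ x
    x≤m+h : x ≤ m + h
    x≤m+h = ≤-trans x≤m (m≤m+n m h)
    c+p≡ : c + p ≡ m + (h + p) ∸ x
    c+p≡ = trans (sym (+-∸-comm p x≤m+h)) (cong (_∸ x) (+-assoc m h p))
    G : ℕ → ℕ
    G y = 𝟙 (not (β (y + p))) * 𝟙 (x + y ≡ᵇ m + h)
    rotate : ∀ u v w → u * (v * w) ≡ w * (u * v)
    rotate = solve-∀
    only-c : ∀ y → 𝟙 (elemᵇ y (applyUpTo b r)) * G y ≡ 𝟙 (y ≡ᵇ c) * (𝟙 (β y) * 𝟙 (not (β (y + p))))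
    only-c y = trans (cong₂ (λ u v → 𝟙 u * (𝟙 (not (β (y + p))) * 𝟙 v))
                       (cong (elemᵇ y) (sym Hr≡))
                       (does-⇔ (mk⇔ (λ e → trans (sym (m+n∸m≡n x y)) (cong (_∸ x) e))
                                    (λ e → trans (cong (x +_) e) (m+[n∸m]≡n x≤m+h)))
                               (x + y ≟ m + h) (y ≟ c)))
                     (rotate (𝟙 (β y)) (𝟙 (not (β (y + p)))) (𝟙 (y ≡ᵇ c)))

  row-sum : ∀ n p h {i} → i < ℓ →
    sumTo (row κ (suc i)) (λ j → 𝟙 (isRowᵇ n κ (suc i) ∧ isColᵇ p κ (suc j)) * 𝟙 (h ≡ᵇ hook κ (suc i , suc j)))
      ≡ 𝟙 (not (α (a i + n))) * 𝟙 (not (beadAt∸ (a i) h) ∧ beadAt∸ (a i) (h + p))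
  row-sum n p h {i} i<ℓ = begin
    sumTo (row κ (suc i)) (λ j → 𝟙 (isRowᵇ n κ (suc i) ∧ isColᵇ p κ (suc j)) * 𝟙 (h ≡ᵇ hook κ (suc i , suc j)))
      ≡⟨ sumTo-cong (row κ (suc i)) in-row ⟩
    sumTo (row κ (suc i)) F
      ≡⟨ sumTo-vanishing F beyond-row (row≤r (suc i)) ⟨
    sumTo r F
      ≡⟨ sumTo-*ˡ r (𝟙 (not (α (a i + n)))) _ ⟩
    𝟙 (not (α (a i + n))) * sumTo r (λ j → 𝟙 (not (β (b j + p))) * 𝟙 (a i + b j ≡ᵇ m + h))
      ≡⟨ cong (𝟙 (not (α (a i + n))) *_) (column-sum p h (a≤m i)) ⟩
    𝟙 (not (α (a i + n))) * 𝟙 (not (beadAt∸ (a i) h) ∧ beadAt∸ (a i) (h + p)) ∎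
    where
    open ≡-Reasoning
    F : ℕ → ℕ
    F j = 𝟙 (not (α (a i + n))) * (𝟙 (not (β (b j + p))) * 𝟙 (a i + b j ≡ᵇ m + h))
    in-row : ∀ j → j < row κ (suc i) →
      𝟙 (isRowᵇ n κ (suc i) ∧ isColᵇ p κ (suc j)) * 𝟙 (h ≡ᵇ hook κ (suc i , suc j)) ≡ F j
    in-row j cell = trans (cong₂ _*_ (𝟙-∧ (not (α (a i + n))) (not (β (b j + p))))
                                     (cong 𝟙 (does-⇔ (mk⇔ to from) (h ≟ hook κ (suc i , suc j)) (a i + b j ≟ m + h))))
                          (*-assoc (𝟙 (not (α (a i + n)))) _ _)
      where
      to : h ≡ hook κ (suc i , suc j) → a i + b j ≡ m + h
      to e = trans (cell-corner i<ℓ cell) (trans (cong (_+ m) (sym e)) (+-comm h m))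
      from : a i + b j ≡ m + h → h ≡ hook κ (suc i , suc j)
      from e = +-cancelʳ-≡ m _ _ (trans (+-comm h m) (trans (sym e) (cell-corner i<ℓ cell)))
    beyond-row : ∀ j → row κ (suc i) ≤ j → j < r → F j ≡ 0
    beyond-row j outside j<r = begin
      F j
        ≡⟨ cong (λ t → 𝟙 (not (α (a i + n))) * (𝟙 (not (β (b j + p))) * 𝟙 t)) no-corner ⟩
      𝟙 (not (α (a i + n))) * (𝟙 (not (β (b j + p))) * 0)
        ≡⟨ cong (𝟙 (not (α (a i + n))) *_) (*-zeroʳ (𝟙 (not (β (b j + p))))) ⟩
      𝟙 (not (α (a i + n))) * 0
        ≡⟨ *-zeroʳ (𝟙 (not (α (a i + n)))) ⟩
      0 ∎
      where
      no-corner : (a i + b j ≡ᵇ m + h) ≡ false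
      no-corner = dec-false (a i + b j ≟ m + h)
        (λ e → <⇒≱ (non-cell-corner i<ℓ j<r (s≤s outside)) (subst (m ≤_) (sym e) (m≤m+n m h)))

  multiplicity-Hnp≡crossings : ∀ n p h → multiplicity h (Hnp n p κ) ≡ crossings n p h
  multiplicity-Hnp≡crossings n p h = begin
    multiplicity h (Hnp n p κ)
      ≡⟨ multiplicity-Hnp≡sum n p h κ ⟩
    sumTo ℓ (λ i → sumTo (row κ (suc i)) (λ j →
      𝟙 (isRowᵇ n κ (suc i) ∧ isColᵇ p κ (suc j)) * 𝟙 (h ≡ᵇ hook κ (suc i , suc j))))
      ≡⟨ sumTo-cong ℓ (λ i → row-sum n p h) ⟩
    sumTo ℓ (Φ ∘ a)
      ≡⟨ sumTo-image ℓ a Φ a-decreasing (λ i _ → s≤s (a≤m i)) ⟩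
    sumTo (suc m) (λ x → 𝟙 (elemᵇ x (applyUpTo a ℓ)) * Φ x)
      ≡⟨ sumTo-cong (suc m) (λ x _ → conjunction x) ⟩
    crossings n p h ∎
    where
    open ≡-Reasoning
    Φ : ℕ → ℕ
    Φ x = 𝟙 (not (α (x + n))) * 𝟙 (not (beadAt∸ x h) ∧ beadAt∸ x (h + p))
    conjunction : ∀ x → 𝟙 (elemᵇ x (applyUpTo a ℓ)) * Φ x
                          ≡ 𝟙 (α x ∧ not (α (x + n)) ∧ not (beadAt∸ x h) ∧ beadAt∸ x (h + p))
    conjunction x = trans (cong (λ u → 𝟙 (elemᵇ x u) * Φ x) (sym Hc≡))
                          (sym (trans (𝟙-∧ (α x) _) (cong (𝟙 (α x) *_) (𝟙-∧ (not (α (x + n))) _))))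

theorem1p3 : (n p : ℕ) → 1 ≤ n → 1 ≤ p → (κ : Partition) →
    IsCore n κ → IsCore p κ → Hnp n p κ ↭ Hnp p n κ
theorem1p3 n p _ _ (mkPartition []       _   _  ) _     _     = ↭-refl
theorem1p3 n p _ _ (mkPartition (r ∷ rs) dec pos) coreₙ coreₚ = multiplicities⇒↭ _ _ λ h → begin
  multiplicity h (Hnp n p κ)  ≡⟨ multiplicity-Hnp≡crossings n p h ⟩
  crossings n p h             ≡⟨ crossings-symmetric (core⇒closed coreₙ) (core⇒closed coreₚ) h ⟩
  crossings p n h             ≡⟨ multiplicity-Hnp≡crossings p n h ⟨
  multiplicity h (Hnp p n κ)  ∎
  where
  open Geometry r rs dec pos
  open Abacus.Bounded α α-bounded
  open ≡-Reasoning
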